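{- Let $G_c$ be a core of a cubic graph $G$. If $G_c$ is bipartite, then $G_c$ is bridgeless.
   Context: Graphs are finite, may have parallel edges, but no loops. A 1-factor is a spanning 1-regular subgraph, identified with its edge set. For $X\subseteq E(G)$, $G[X]$ is the graph with edge set $X$ and vertex set all endpoints of edges of $X$. For three pairwise different 1-factors $M_1,M_2,M_3$ of a cubic graph $G$, let $\mathcal{M} = \bigcup_{i\neq j}(M_i\cap M_j)$ and $\mathcal{U} = E(G) - (M_1\cup M_2\cup M_3)$; the graph $G[\mathcal{M}\cup\mathcal{U}]$ is called the core of $G$ with respect to $M_1,M_2,M_3$, and a core of $G$ is the core with respect to some three pairwise different 1-factors. -}

module Defs where

open import Data.Nat using (ℕ; zero; suc; _+_)
open import Data.Bool using (Bool; true; false; _∧_; _∨_; not; if_then_else_)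
open import Data.Fin using (Fin; _≟_)
open import Data.Fin.Subset using (Subset; _∈_; _∉_)
open import Data.Vec using (tabulate; lookup)
open import Data.List using (List; length; filter)
open import Data.List.Base using (allFin)
open import Data.Product using (_×_; _,_; proj₁; proj₂; Σ; ∃)
open import Data.Sum using (_⊎_)
open import Relation.Binary.PropositionalEquality using (_≡_; _≢_)
open import Relation.Nullary using (¬_; Dec; yes; no)
open import Relation.Nullary.Decidable using (_⊎-dec_)

-- A finite multigraph without loops: vertices Fin n, edges Fin m,
-- each edge has two (distinct) endpoints; parallel edges allowed.
record Graph : Set where
  field
    n      : ℕ
    m      : ℕ
    ends   : Fin m → Fin n × Fin n
    noLoop : ∀ e → proj₁ (ends e) ≢ proj₂ (ends e)

open Graph public

Incident : (G : Graph) → Fin (m G) → Fin (n G) → Set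
Incident G e v = (proj₁ (ends G e) ≡ v) ⊎ (proj₂ (ends G e) ≡ v)

incident? : (G : Graph) → (e : Fin (m G)) → (v : Fin (n G)) → Dec (Incident G e v)
incident? G e v = (proj₁ (ends G e) ≟ v) ⊎-dec (proj₂ (ends G e) ≟ v)

degree : (G : Graph) → Fin (n G) → ℕ
degree G v = length (filter (λ e → incident? G e v) (allFin (m G)))

Cubic : Graph → Set
Cubic G = ∀ v → degree G v ≡ 3

IsOneFactor : (G : Graph) → Subset (m G) → Set
IsOneFactor G M = ∀ v → Σ (Fin (m G)) λ e →
  (e ∈ M) × Incident G e v × (∀ f → f ∈ M → Incident G f v → f ≡ e)

-- edge set  𝓜 ∪ 𝓤  of the core with respect to M₁, M₂, M₃:
-- edges lying in at least two of the M_i, or in none of them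
coreEdges : ∀ {k} → Subset k → Subset k → Subset k → Subset k
coreEdges M₁ M₂ M₃ = tabulate λ e →
  let a = lookup M₁ e ; b = lookup M₂ e ; c = lookup M₃ e in
  ((a ∧ b) ∨ (a ∧ c) ∨ (b ∧ c)) ∨ not (a ∨ b ∨ c)

-- G[X] is bipartite: a 2-colouring of the vertices in which every edge
-- of X joins vertices of different colours (vertices outside G[X] are
-- irrelevant to the condition)
Bipartite : (G : Graph) → Subset (m G) → Set
Bipartite G X = ∃ λ (col : Fin (n G) → Bool) →
  ∀ e → e ∈ X → col (proj₁ (ends G e)) ≢ col (proj₂ (ends G e))

-- Connected G X e u v : u and v are joined by a walk in G[X] - e,
-- i.e. a walk using only edges of X other than e.
data Connected (G : Graph) (X : Subset (m G)) (e : Fin (m G)) :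
     Fin (n G) → Fin (n G) → Set where
  here : ∀ {u} → Connected G X e u u
  step : ∀ {v} (f : Fin (m G)) → f ∈ X → f ≢ e →
         Connected G X e (proj₂ (ends G f)) v →
         Connected G X e (proj₁ (ends G f)) v
  stepᵒ : ∀ {v} (f : Fin (m G)) → f ∈ X → f ≢ e →
         Connected G X e (proj₁ (ends G f)) v →
         Connected G X e (proj₂ (ends G f)) v

-- e ∈ X is a bridge of G[X]: deleting it disconnects its endpoints
-- (equivalently, increases the number of components of G[X])
IsBridge : (G : Graph) → Subset (m G) → Fin (m G) → Set
IsBridge G X e = e ∈ X × ¬ Connected G X e (proj₁ (ends G e)) (proj₂ (ends G e))

Bridgeless : (G : Graph) → Subset (m G) → Set
Bridgeless G X = ∀ e → ¬ IsBridge G X e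

-- Give an edge f the weight w(f) = |{i : f ∈ Mᵢ}| − 1. It vanishes exactly on the edges lying
-- in exactly one Mᵢ, i.e. off the core, and at every vertex of the cubic graph the weights of
-- the three incident edges add up to 3 − 3 = 0. Let e be a bridge of a bipartite core, S the
-- vertex set of the component of (core − e) containing one end of e, and ± the sign of the
-- colour class. Summing ± times the vertex sums over S gives 0. Regrouped by edges, every core
-- edge other than e has both ends in S, where the signs cancel, or both ends outside S, so
-- only ±w(e) survives. Hence w(e) = 0, which is impossible on a core edge.
module Submission where

open import Defs
import Data.Integer.Properties as ℤ
open import Algebra.Properties.Semiring.Sum ℤ.+-*-semiring
  using (sum; sum-syntax; sum-cong-≗; sum-replicate-zero; ∑-distrib-+; ∑-comm; *-distribˡ-sum)
open import Data.Bool using (Bool; true; false; _∧_; _∨_; not)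
open import Data.Empty using (⊥-elim)
open import Data.Nat using (zero; suc)
open import Data.Fin using (Fin; zero; suc; _≟_)
open import Data.Fin.Subset using (Subset; _∈_; _∉_)
open import Data.Fin.Subset.Properties using (_∈?_)
open import Data.Integer using (ℤ; +_; 0ℤ; 1ℤ; -1ℤ; _+_; _*_; _-_)
open import Data.Integer.Tactic.RingSolver using (solve-∀)
open import Data.List using (length; filter; tabulate)
open import Data.Product using (_×_; _,_; proj₁; proj₂)
open import Data.Sum using (inj₁; inj₂)
open import Data.Vec using (lookup)
open import Data.Vec.Properties using ([]=⇒lookup; lookup⇒[]=; lookup∘tabulate)
open import Function using (_∘_)
open import Relation.Nullary using (¬_; Dec; yes; no; does)
open import Relation.Nullary.Decidable using (dec-true; dec-false; _⊎-dec_; decidable-stable; ¬¬-excluded-middle)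
open import Relation.Binary.PropositionalEquality using (_≡_; _≢_; refl; sym; trans; cong; cong₂; module ≡-Reasoning)

open ≡-Reasoning

𝟙 : Bool → ℤ
𝟙 true  = 1ℤ
𝟙 false = 0ℤ

δ : ∀ {k} → Fin k → Fin k → ℤ
δ i j = 𝟙 (does (i ≟ j))

δ-refl : ∀ {k} (i : Fin k) → δ i i ≡ 1ℤ
δ-refl i = cong 𝟙 (dec-true (i ≟ i) refl)

δ-≢ : ∀ {k} {i j : Fin k} → i ≢ j → δ i j ≡ 0ℤ
δ-≢ {i = i} {j} i≢j = cong 𝟙 (dec-false (i ≟ j) i≢j)

𝟙-⊎-dec : ∀ {p q} {P : Set p} {Q : Set q} (P? : Dec P) (Q? : Dec Q) →
          ¬ (P × Q) → 𝟙 (does (P? ⊎-dec Q?)) ≡ 𝟙 (does P?) + 𝟙 (does Q?)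
𝟙-⊎-dec (yes p) (yes q) ¬pq = ⊥-elim (¬pq (p , q))
𝟙-⊎-dec (yes _) (no _)  _   = refl
𝟙-⊎-dec (no _)  (yes _) _   = refl
𝟙-⊎-dec (no _)  (no _)  _   = refl


∑-δ : ∀ {k} (i : Fin k) (g : Fin k → ℤ) → ∑[ j < k ] (δ i j * g j) ≡ g i
∑-δ {suc k} zero g = begin
  1ℤ * g zero + ∑[ j < k ] (0ℤ * g (suc j))  ≡⟨ cong₂ _+_ (ℤ.*-identityˡ (g zero)) (sum-cong-≗ (ℤ.*-zeroˡ ∘ g ∘ suc)) ⟩
  g zero + ∑[ j < k ] 0ℤ                     ≡⟨ cong (_+_ (g zero)) (sum-replicate-zero k) ⟩
  g zero + 0ℤ                                ≡⟨ ℤ.+-identityʳ (g zero) ⟩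
  g zero                                     ∎
∑-δ {suc k} (suc i) g = begin
  0ℤ * g zero + ∑[ j < k ] (δ i j * g (suc j))  ≡⟨ cong (_+ ∑[ j < k ] (δ i j * g (suc j))) (ℤ.*-zeroˡ (g zero)) ⟩
  0ℤ + ∑[ j < k ] (δ i j * g (suc j))           ≡⟨ ℤ.+-identityˡ (∑[ j < k ] (δ i j * g (suc j))) ⟩
  ∑[ j < k ] (δ i j * g (suc j))                ≡⟨ ∑-δ i (g ∘ suc) ⟩
  g (suc i)                                     ∎

∑-δ-one : ∀ {k} (i : Fin k) → ∑[ j < k ] δ i j ≡ 1ℤ
∑-δ-one {k} i = trans (sum-cong-≗ (sym ∘ ℤ.*-identityʳ ∘ δ i)) (∑-δ i (λ _ → 1ℤ))

length-filter-tabulate : ∀ {A : Set} {P : A → Set} (P? : ∀ x → Dec (P x)) {k} (g : Fin k → A) →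
                         + length (filter P? (tabulate g)) ≡ ∑[ i < k ] 𝟙 (does (P? (g i)))
length-filter-tabulate P? {zero}  g = refl
length-filter-tabulate P? {suc k} g with P? (g zero)
... | yes _ = cong (_+_ 1ℤ) (length-filter-tabulate P? (g ∘ suc))
... | no _  = trans (length-filter-tabulate P? (g ∘ suc)) (sym (ℤ.+-identityˡ _))

¬¬-decidable : ∀ {k p} (P : Fin k → Set p) → ¬ ¬ (∀ i → Dec (P i))
¬¬-decidable {zero}  P k = k (λ ())
¬¬-decidable {suc _} P k = ¬¬-excluded-middle λ P₀? →
  ¬¬-decidable (P ∘ suc) λ P? → k λ { zero → P₀? ; (suc i) → P? i }

sign : Bool → ℤ
sign true  = 1ℤ
sign false = -1ℤ

sign-opposite : ∀ {x y} → x ≢ y → sign x + sign y ≡ 0ℤ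
sign-opposite {true}  {true}  x≢y = ⊥-elim (x≢y refl)
sign-opposite {true}  {false} _   = refl
sign-opposite {false} {true}  _   = refl
sign-opposite {false} {false} x≢y = ⊥-elim (x≢y refl)

*-sign≡0 : ∀ i x → i * sign x ≡ 0ℤ → i ≡ 0ℤ
*-sign≡0 i x eq with ℤ.i*j≡0⇒i≡0∨j≡0 i eq
... | inj₁ i≡0 = i≡0
*-sign≡0 i true  eq | inj₂ ()
*-sign≡0 i false eq | inj₂ ()

module _ (G : Graph) where

  src tgt : Fin (m G) → Fin (n G)
  src f = proj₁ (ends G f)
  tgt f = proj₂ (ends G f)

  incidence : Fin (m G) → Fin (n G) → ℤ
  incidence f v = 𝟙 (does (incident? G f v))

  incidence-endpoints : ∀ f v → incidence f v ≡ δ (src f) v + δ (tgt f) v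
  incidence-endpoints f v =
    𝟙-⊎-dec (src f ≟ v) (tgt f ≟ v) (λ (p , q) → noLoop G f (trans p (sym q)))

  incidence-yes : ∀ {f v} → Incident G f v → incidence f v ≡ 1ℤ
  incidence-yes {f} {v} inc = cong 𝟙 (dec-true (incident? G f v) inc)

  incidence-no : ∀ {f v} → ¬ Incident G f v → incidence f v ≡ 0ℤ
  incidence-no {f} {v} ¬inc = cong 𝟙 (dec-false (incident? G f v) ¬inc)

  ∑-incidence : ∀ f (g : Fin (n G) → ℤ) → ∑[ v < n G ] (incidence f v * g v) ≡ g (src f) + g (tgt f)
  ∑-incidence f g = begin
    ∑[ v < n G ] (incidence f v * g v)                          ≡⟨ sum-cong-≗ split ⟩
    ∑[ v < n G ] (δ (src f) v * g v + δ (tgt f) v * g v)        ≡⟨ ∑-distrib-+ (λ v → δ (src f) v * g v) (λ v → δ (tgt f) v * g v) ⟩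
    ∑[ v < n G ] (δ (src f) v * g v) + ∑[ v < n G ] (δ (tgt f) v * g v)
                                                                ≡⟨ cong₂ _+_ (∑-δ (src f) g) (∑-δ (tgt f) g) ⟩
    g (src f) + g (tgt f)                                       ∎
    where
    split : ∀ v → incidence f v * g v ≡ δ (src f) v * g v + δ (tgt f) v * g v
    split v = trans (cong (_* g v) (incidence-endpoints f v)) (ℤ.*-distribʳ-+ (g v) (δ (src f) v) (δ (tgt f) v))

  ∑-incidence-degree : ∀ v → ∑[ f < m G ] incidence f v ≡ + degree G v
  ∑-incidence-degree v = sym (length-filter-tabulate (λ f → incident? G f v) (λ f → f))

  ∑-incidence-oneFactor : ∀ {M} → IsOneFactor G M → ∀ v →
                          ∑[ f < m G ] (incidence f v * 𝟙 (lookup M f)) ≡ 1ℤ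
  ∑-incidence-oneFactor {M} factor v with factor v
  ... | e , e∈M , e∋v , unique = trans (sum-cong-≗ only-e) (∑-δ-one e)
    where
    outside-e : ∀ {f} → f ≢ e → incidence f v * 𝟙 (lookup M f) ≡ 0ℤ
    outside-e {f} f≢e with lookup M f in f∈?M
    ... | false = ℤ.*-zeroʳ (incidence f v)
    ... | true with incident? G f v
    ...   | yes f∋v = ⊥-elim (f≢e (unique f (lookup⇒[]= f M f∈?M) f∋v))
    ...   | no f∌v  = cong (_* 1ℤ) (incidence-no f∌v)

    only-e : ∀ f → incidence f v * 𝟙 (lookup M f) ≡ δ e f
    only-e f with f ≟ e
    ... | yes refl = trans (cong₂ _*_ (incidence-yes e∋v) (cong 𝟙 ([]=⇒lookup e∈M))) (sym (δ-refl e))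
    ... | no f≢e   = trans (outside-e f≢e) (sym (δ-≢ (f≢e ∘ sym)))

  ∑-vertex-sums : ∀ (g : Fin (n G) → ℤ) (w : Fin (m G) → ℤ) →
                  ∑[ v < n G ] (g v * ∑[ f < m G ] (incidence f v * w f))
                  ≡ ∑[ f < m G ] (w f * (g (src f) + g (tgt f)))
  ∑-vertex-sums g w = begin
    ∑[ v < n G ] (g v * ∑[ f < m G ] (incidence f v * w f))     ≡⟨ sum-cong-≗ (λ v → *-distribˡ-sum (g v) (λ f → incidence f v * w f)) ⟩
    ∑[ v < n G ] ∑[ f < m G ] (g v * (incidence f v * w f))     ≡⟨ ∑-comm (λ v f → g v * (incidence f v * w f)) ⟩
    ∑[ f < m G ] ∑[ v < n G ] (g v * (incidence f v * w f))     ≡⟨ sum-cong-≗ pull-out-w ⟩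
    ∑[ f < m G ] (w f * ∑[ v < n G ] (incidence f v * g v))     ≡⟨ sum-cong-≗ (λ f → cong (w f *_) (∑-incidence f g)) ⟩
    ∑[ f < m G ] (w f * (g (src f) + g (tgt f)))                ∎
    where
    rearrange : ∀ x i y → x * (i * y) ≡ y * (i * x)
    rearrange = solve-∀

    pull-out-w : ∀ f → ∑[ v < n G ] (g v * (incidence f v * w f)) ≡ w f * ∑[ v < n G ] (incidence f v * g v)
    pull-out-w f = trans (sum-cong-≗ (λ v → rearrange (g v) (incidence f v) (w f)))
                         (sym (*-distribˡ-sum (w f) (λ v → incidence f v * g v)))

module _ (G : Graph) (X : Subset (m G)) (e : Fin (m G)) where

  extend : ∀ {x f} → Connected G X e x (src G f) → f ∈ X → f ≢ e → Connected G X e x (tgt G f)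
  extend here                  f∈X f≢e = step _ f∈X f≢e here
  extend (step g g∈X g≢e p)   f∈X f≢e = step g g∈X g≢e (extend p f∈X f≢e)
  extend (stepᵒ g g∈X g≢e p)  f∈X f≢e = stepᵒ g g∈X g≢e (extend p f∈X f≢e)

  extendᵒ : ∀ {x f} → Connected G X e x (tgt G f) → f ∈ X → f ≢ e → Connected G X e x (src G f)
  extendᵒ here                 f∈X f≢e = stepᵒ _ f∈X f≢e here
  extendᵒ (step g g∈X g≢e p)  f∈X f≢e = step g g∈X g≢e (extendᵒ p f∈X f≢e)
  extendᵒ (stepᵒ g g∈X g≢e p) f∈X f≢e = stepᵒ g g∈X g≢e (extendᵒ p f∈X f≢e)

module _ (G : Graph) (X : Subset (m G)) (w : Fin (m G) → ℤ)
         (w-outside : ∀ f → f ∉ X → w f ≡ 0ℤ)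
         (w-balanced : ∀ v → ∑[ f < m G ] (incidence G f v * w f) ≡ 0ℤ)
         (col : Fin (n G) → Bool)
         (proper : ∀ f → f ∈ X → col (src G f) ≢ col (tgt G f))
         (e : Fin (m G))
         (cut : ¬ Connected G X e (src G e) (tgt G e)) where

  module _ (reach? : ∀ v → Dec (Connected G X e (src G e) v)) where

    side : Fin (n G) → ℤ
    side v with reach? v
    ... | yes _ = sign (col v)
    ... | no _  = 0ℤ

    side-cancels : ∀ {f} → f ∈ X → f ≢ e → side (src G f) + side (tgt G f) ≡ 0ℤ
    side-cancels {f} f∈X f≢e with reach? (src G f) | reach? (tgt G f)
    ... | yes _  | yes _  = sign-opposite (proper f f∈X)
    ... | yes p  | no ¬q  = ⊥-elim (¬q (extend G X e p f∈X f≢e))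
    ... | no ¬p  | yes q  = ⊥-elim (¬p (extendᵒ G X e q f∈X f≢e))
    ... | no _   | no _   = refl

    side-across-bridge : side (src G e) + side (tgt G e) ≡ sign (col (src G e))
    side-across-bridge with reach? (src G e) | reach? (tgt G e)
    ... | yes _ | no _  = ℤ.+-identityʳ _
    ... | _     | yes q = ⊥-elim (cut q)
    ... | no ¬p | _     = ⊥-elim (¬p here)

    contribution : ℤ
    contribution = w e * sign (col (src G e))

    edge-term : ∀ f → w f * (side (src G f) + side (tgt G f)) ≡ δ e f * contribution
    edge-term f with f ≟ e
    ... | yes refl = trans (cong (w e *_) side-across-bridge)
                           (sym (trans (cong (_* contribution) (δ-refl e)) (ℤ.*-identityˡ contribution)))
    ... | no f≢e   = trans vanishes (sym (trans (cong (_* contribution) (δ-≢ (f≢e ∘ sym))) (ℤ.*-zeroˡ contribution)))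
      where
      vanishes : w f * (side (src G f) + side (tgt G f)) ≡ 0ℤ
      vanishes with f ∈? X
      ... | yes f∈X = trans (cong (w f *_) (side-cancels f∈X f≢e)) (ℤ.*-zeroʳ (w f))
      ... | no f∉X  = trans (cong (_* sides) (w-outside f f∉X)) (ℤ.*-zeroˡ sides)
        where sides = side (src G f) + side (tgt G f)

    bridge-weight≡0-by-reachability : w e ≡ 0ℤ
    bridge-weight≡0-by-reachability = *-sign≡0 (w e) (col (src G e)) (begin
      contribution                                                  ≡⟨ ∑-δ e (λ _ → contribution) ⟨
      ∑[ f < m G ] (δ e f * contribution)                           ≡⟨ sum-cong-≗ edge-term ⟨
      ∑[ f < m G ] (w f * (side (src G f) + side (tgt G f)))        ≡⟨ ∑-vertex-sums G side w ⟨
      ∑[ v < n G ] (side v * ∑[ f < m G ] (incidence G f v * w f))  ≡⟨ sum-cong-≗ (λ v → cong (side v *_) (w-balanced v)) ⟩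
      ∑[ v < n G ] (side v * 0ℤ)                                    ≡⟨ sum-cong-≗ (ℤ.*-zeroʳ ∘ side) ⟩
      ∑[ v < n G ] 0ℤ                                               ≡⟨ sum-replicate-zero (n G) ⟩
      0ℤ                                                            ∎)

  -- Reachability from src e need not be decidable: the goal is, so ¬¬-decidability suffices.
  bridge-weight≡0 : w e ≡ 0ℤ
  bridge-weight≡0 = decidable-stable (w e ℤ.≟ 0ℤ) λ w≢0 →
    ¬¬-decidable _ (w≢0 ∘ bridge-weight≡0-by-reachability)

lookup-∉ : ∀ {k} {p : Subset k} {x} → x ∉ p → lookup p x ≡ false
lookup-∉ {p = p} {x} x∉p with lookup p x in p[x]
... | true  = ⊥-elim (x∉p (lookup⇒[]= x p p[x]))
... | false = refl

inCore : Bool → Bool → Bool → Bool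
inCore x y z = ((x ∧ y) ∨ (x ∧ z) ∨ (y ∧ z)) ∨ not (x ∨ y ∨ z)

coreWeight : Bool → Bool → Bool → ℤ
coreWeight x y z = 𝟙 x + 𝟙 y + 𝟙 z - 1ℤ

coreWeight-outside : ∀ x y z → inCore x y z ≡ false → coreWeight x y z ≡ 0ℤ
coreWeight-outside true  false false _ = refl
coreWeight-outside false true  false _ = refl
coreWeight-outside false false true  _ = refl
coreWeight-outside true  true  true  ()
coreWeight-outside true  true  false ()
coreWeight-outside true  false true  ()
coreWeight-outside false true  true  ()
coreWeight-outside false false false ()

coreWeight-inside : ∀ x y z → inCore x y z ≡ true → coreWeight x y z ≢ 0ℤ
coreWeight-inside true  true  true  _ ()
coreWeight-inside true  true  false _ ()
coreWeight-inside true  false true  _ ()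
coreWeight-inside false true  true  _ ()
coreWeight-inside false false false _ ()
coreWeight-inside true  false false ()
coreWeight-inside false true  false ()
coreWeight-inside false false true  ()

module CoreWeight (G : Graph) (M₁ M₂ M₃ : Subset (m G)) where

  weight : Fin (m G) → ℤ
  weight f = coreWeight (lookup M₁ f) (lookup M₂ f) (lookup M₃ f)

  lookup-coreEdges : ∀ f → lookup (coreEdges M₁ M₂ M₃) f ≡ inCore (lookup M₁ f) (lookup M₂ f) (lookup M₃ f)
  lookup-coreEdges = lookup∘tabulate _

  weight-outside-core : ∀ f → f ∉ coreEdges M₁ M₂ M₃ → weight f ≡ 0ℤ
  weight-outside-core f f∉X =
    coreWeight-outside (lookup M₁ f) (lookup M₂ f) (lookup M₃ f) (trans (sym (lookup-coreEdges f)) (lookup-∉ f∉X))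

  weight-inside-core : ∀ {f} → f ∈ coreEdges M₁ M₂ M₃ → weight f ≢ 0ℤ
  weight-inside-core {f} f∈X =
    coreWeight-inside (lookup M₁ f) (lookup M₂ f) (lookup M₃ f) (trans (sym (lookup-coreEdges f)) ([]=⇒lookup f∈X))

  weight-balanced : Cubic G → IsOneFactor G M₁ → IsOneFactor G M₂ → IsOneFactor G M₃ →
                    ∀ v → ∑[ f < m G ] (incidence G f v * weight f) ≡ 0ℤ
  weight-balanced cubic F₁ F₂ F₃ v = begin
    ∑[ f < m G ] (I f * weight f)                             ≡⟨ sum-cong-≗ expand ⟩
    ∑[ f < m G ] (P₁ f + P₂ f + P₃ f + -1ℤ * I f)             ≡⟨ ∑-distrib-+ (λ f → P₁ f + P₂ f + P₃ f) (λ f → -1ℤ * I f) ⟩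
    ∑[ f < m G ] (P₁ f + P₂ f + P₃ f) + ∑[ f < m G ] (-1ℤ * I f)
      ≡⟨ cong₂ _+_ (trans (∑-distrib-+ (λ f → P₁ f + P₂ f) P₃) (cong (_+ sum P₃) (∑-distrib-+ P₁ P₂)))
                   (sym (*-distribˡ-sum -1ℤ I)) ⟩
    sum P₁ + sum P₂ + sum P₃ + -1ℤ * sum I
      ≡⟨ cong₂ _+_ (cong₂ _+_ (cong₂ _+_ (∑-incidence-oneFactor G F₁ v) (∑-incidence-oneFactor G F₂ v))
                              (∑-incidence-oneFactor G F₃ v))
                   (cong (-1ℤ *_) (trans (∑-incidence-degree G v) (cong +_ (cubic v)))) ⟩
    1ℤ + 1ℤ + 1ℤ + -1ℤ * + 3                                 ≡⟨⟩
    0ℤ                                                        ∎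
    where
    I P₁ P₂ P₃ : Fin (m G) → ℤ
    I f  = incidence G f v
    P₁ f = I f * 𝟙 (lookup M₁ f)
    P₂ f = I f * 𝟙 (lookup M₂ f)
    P₃ f = I f * 𝟙 (lookup M₃ f)

    distribute : ∀ i x y z → i * (x + y + z - 1ℤ) ≡ i * x + i * y + i * z + -1ℤ * i
    distribute = solve-∀

    expand : ∀ f → I f * weight f ≡ P₁ f + P₂ f + P₃ f + -1ℤ * I f
    expand f = distribute (I f) (𝟙 (lookup M₁ f)) (𝟙 (lookup M₂ f)) (𝟙 (lookup M₃ f))

-- The three 1-factors need not be pairwise different for the argument.
mainTheorem11 : (G : Graph) → Cubic G →
    (M₁ M₂ M₃ : Subset (m G)) →
    IsOneFactor G M₁ → IsOneFactor G M₂ → IsOneFactor G M₃ →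
    M₁ ≢ M₂ → M₁ ≢ M₃ → M₂ ≢ M₃ →
    Bipartite G (coreEdges M₁ M₂ M₃) →
    Bridgeless G (coreEdges M₁ M₂ M₃)
mainTheorem11 G cubic M₁ M₂ M₃ F₁ F₂ F₃ _ _ _ (col , proper) e (e∈core , cut) =
  weight-inside-core e∈core
    (bridge-weight≡0 G (coreEdges M₁ M₂ M₃) weight weight-outside-core
       (weight-balanced cubic F₁ F₂ F₃) col proper e cut)
  where open CoreWeight G M₁ M₂ M₃
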